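{- Let $m,n\geq 1$ be integers with $\gcd(n,m)=1$, and let $R=(r_1,\dots,r_m)\in\mathbb{N}^m$ and $C=(c_1,\dots,c_n)\in\mathbb{N}^n$. Then there is at most one $m\times n$ binary matrix $A=(a_{i,j})$ that is $(1,1)$-periodical and has row sums $R$ and column sums $C$, i.e. $\sum_{j=1}^n a_{i,j}=r_i$ for all $1\le i\le m$ and $\sum_{i=1}^m a_{i,j}=c_j$ for all $1\le j\le n$.
   Context: An $m\times n$ binary matrix $A=(a_{i,j})$ (rows indexed $1,\dots,m$ from top, columns $1,\dots,n$ from left) is called $(p,q)$-periodical, for integers $p,q$, if whenever $a_{i,j}=1$ we have $a_{i+p,j+q}=1$ provided $1\le i+p\le m$ and $1\le j+q\le n$, and $a_{i-p,j-q}=1$ provided $1\le i-p\le m$ and $1\le j-q\le n$. -}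

module Defs where

open import Data.Nat using (ℕ; zero; suc)
open import Data.Fin using (Fin; toℕ)
open import Data.Bool using (Bool; true; false)
open import Data.Integer using (ℤ; +_; _+_; _-_)
open import Relation.Binary.PropositionalEquality using (_≡_)

-- An m × n binary matrix; rows/columns indexed 0-based by Fin
-- (row i of Fin corresponds to row i+1 of the paper).
BinMatrix : ℕ → ℕ → Set
BinMatrix m n = Fin m → Fin n → Bool

bit : Bool → ℕ
bit true  = 1
bit false = 0

∑ : (k : ℕ) → (Fin k → ℕ) → ℕ
∑ zero    f = 0
∑ (suc k) f = f Fin.zero Data.Nat.+ ∑ k (λ i → f (Fin.suc i))
  where import Data.Nat

rowSum : ∀ {m n} → BinMatrix m n → Fin m → ℕ
rowSum {m} {n} A i = ∑ n (λ j → bit (A i j))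

colSum : ∀ {m n} → BinMatrix m n → Fin n → ℕ
colSum {m} {n} A j = ∑ m (λ i → bit (A i j))

Periodical : ∀ {m n} → ℤ → ℤ → BinMatrix m n → Set
Periodical {m} {n} p q A =
  (i i' : Fin m) (j j' : Fin n) → A i j ≡ true →
    ((+ toℕ i' ≡ + toℕ i + p) → (+ toℕ j' ≡ + toℕ j + q) → A i' j' ≡ true)
  Data.Product.× ((+ toℕ i' ≡ + toℕ i - p) → (+ toℕ j' ≡ + toℕ j - q) → A i' j' ≡ true)
  where import Data.Product

{-# OPTIONS --safe #-}
-- The difference D = A − B is constant along diagonals, by periodicity. Comparing the sums of
-- rows i and i+1 (resp. columns j and j+1), which share all but one entry up to that diagonal
-- shift, gives D(i, n−1) = D(i+1, 0) (resp. D(m−1, j) = D(0, j+1)). So D is invariant under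
-- the shift (i, j) ↦ (i+1 mod m, j+1 mod n) of the torus, except across the corner
-- (m−1, n−1) ↦ (0, 0). After t shifts from (0, 0) we are at (t mod m, t mod n); since
-- gcd(m, n) = 1 these cells are distinct for t < mn (Chinese remainder theorem), so this walk
-- visits every cell and crosses the corner only after its last step. Hence D is constant, and
-- the constant is 0 because the entries of row 0 of D sum to 0.
module Submission where

open import Data.Bool using (true; false)
open import Data.Fin using (Fin; zero; suc; toℕ; fromℕ; inject₁; combine; punchOut)
open import Data.Fin.Properties
  using (toℕ-injective; toℕ-fromℕ; toℕ-fromℕ<; toℕ-inject₁; toℕ<n; any?; combine-injective;
         punchOut-injective; injective⇒≤)
  renaming (_≟_ to _≟ᶠ_)
open import Data.Integer using (ℤ; +_; _⊖_; _-_) renaming (_+_ to _+ℤ_; _*_ to _*ℤ_)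
import Data.Integer.Properties as ℤ
import Data.Integer.Tactic.RingSolver as ℤ-Solver
open import Data.Nat using (ℕ; zero; suc; _+_; _*_; _∸_; _≤_; _<_; _≥_; NonZero; z≤n)
open import Data.Nat.Properties
open import Data.Nat.DivMod
open import Data.Nat.Divisibility using (_∣_; divides; m%n≡0⇒n∣m; ∣⇒≤)
open import Data.Nat.GCD using (gcd; gcd-comm)
open import Data.Nat.LCM using (lcm; lcm-least; gcd*lcm)
open import Data.Product using (∃; _×_; _,_; proj₁; proj₂)
open import Data.Sum using (inj₁; inj₂)
open import Function using (_∘_)
open import Function.Definitions using (Injective)
open import Relation.Nullary using (yes; no; ¬_; contradiction)
open import Relation.Binary.PropositionalEquality

open import Defs

open ≡-Reasoning

∑-cong : ∀ k {f g : Fin k → ℕ} → (∀ i → f i ≡ g i) → ∑ k f ≡ ∑ k g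
∑-cong zero    f≗g = refl
∑-cong (suc k) f≗g = cong₂ _+_ (f≗g zero) (∑-cong k (f≗g ∘ suc))

∑-last : ∀ k (f : Fin (suc k) → ℕ) → ∑ (suc k) f ≡ ∑ k (f ∘ inject₁) + f (fromℕ k)
∑-last zero    f = +-comm (f zero) 0
∑-last (suc k) f =
  trans (cong (_+_ (f zero)) (∑-last k (f ∘ suc))) (sym (+-assoc (f zero) _ _))

+≡+⇒⊖≡⊖ : ∀ x y a b → x + a ≡ y + b → a ⊖ b ≡ y ⊖ x
+≡+⇒⊖≡⊖ x y a b eq = begin
  a ⊖ b             ≡⟨ ℤ.+-cancelˡ-⊖ x a b ⟨
  (x + a) ⊖ (x + b) ≡⟨ cong₂ _⊖_ (trans eq (+-comm y b)) (+-comm x b) ⟩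
  (b + y) ⊖ (b + x) ≡⟨ ℤ.+-cancelˡ-⊖ b y x ⟩
  y ⊖ x             ∎

[m+n]⊖[o+p]≡m⊖o+n⊖p : ∀ m n o p → (m + n) ⊖ (o + p) ≡ (m ⊖ o) +ℤ (n ⊖ p)
[m+n]⊖[o+p]≡m⊖o+n⊖p m n o p = begin
  (m + n) ⊖ (o + p)               ≡⟨ ℤ.[+m]-[+n]≡m⊖n (m + n) (o + p) ⟨
  + (m + n) - + (o + p)           ≡⟨ cong₂ _-_ (ℤ.pos-+ m n) (ℤ.pos-+ o p) ⟩
  (+ m +ℤ + n) - (+ o +ℤ + p)     ≡⟨ regroup (+ m) (+ n) (+ o) (+ p) ⟩
  (+ m - + o) +ℤ (+ n - + p)      ≡⟨ cong₂ _+ℤ_ (ℤ.[+m]-[+n]≡m⊖n m o) (ℤ.[+m]-[+n]≡m⊖n n p) ⟩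
  (m ⊖ o) +ℤ (n ⊖ p)              ∎
  where
  regroup : ∀ a b c d → (a +ℤ b) - (c +ℤ d) ≡ (a - c) +ℤ (b - d)
  regroup = ℤ-Solver.solve-∀

∑-shift-⊖ : ∀ k (a a' b b' : Fin (suc k) → ℕ) →
  (∀ j → a (inject₁ j) ≡ a' (suc j)) → (∀ j → b (inject₁ j) ≡ b' (suc j)) →
  ∑ (suc k) a ≡ ∑ (suc k) b → ∑ (suc k) a' ≡ ∑ (suc k) b' →
  a (fromℕ k) ⊖ b (fromℕ k) ≡ a' zero ⊖ b' zero
∑-shift-⊖ k a a' b b' a≗a' b≗b' ∑a≡∑b ∑a'≡∑b' = begin
  a (fromℕ k) ⊖ b (fromℕ k)              ≡⟨ +≡+⇒⊖≡⊖ _ _ (a (fromℕ k)) (b (fromℕ k)) lower ⟩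
  ∑ k (b ∘ inject₁) ⊖ ∑ k (a ∘ inject₁)  ≡⟨ cong₂ _⊖_ (∑-cong k b≗b') (∑-cong k a≗a') ⟩
  ∑ k (b' ∘ suc) ⊖ ∑ k (a' ∘ suc)        ≡⟨ +≡+⇒⊖≡⊖ (∑ k (a' ∘ suc)) _ (a' zero) (b' zero) upper ⟨
  a' zero ⊖ b' zero                      ∎
  where
  lower : ∑ k (a ∘ inject₁) + a (fromℕ k) ≡ ∑ k (b ∘ inject₁) + b (fromℕ k)
  lower = trans (sym (∑-last k a)) (trans ∑a≡∑b (∑-last k b))
  upper : ∑ k (a' ∘ suc) + a' zero ≡ ∑ k (b' ∘ suc) + b' zero
  upper = trans (+-comm _ (a' zero)) (trans ∑a'≡∑b' (+-comm (b' zero) _))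

∑-⊖-constant : ∀ k (f g : Fin k → ℕ) {c} → (∀ i → f i ⊖ g i ≡ c) → ∑ k f ⊖ ∑ k g ≡ + k *ℤ c
∑-⊖-constant zero    f g         f⊖g≡c = refl
∑-⊖-constant (suc k) f g {c} f⊖g≡c = begin
  (f zero + ∑ k (f ∘ suc)) ⊖ (g zero + ∑ k (g ∘ suc))   ≡⟨ [m+n]⊖[o+p]≡m⊖o+n⊖p (f zero) _ (g zero) _ ⟩
  (f zero ⊖ g zero) +ℤ (∑ k (f ∘ suc) ⊖ ∑ k (g ∘ suc))  ≡⟨ cong₂ _+ℤ_ (f⊖g≡c zero) tail ⟩
  c +ℤ + k *ℤ c                                         ≡⟨ ℤ.suc-* (+ k) c ⟨
  + suc k *ℤ c                                          ∎
  where
  tail : ∑ k (f ∘ suc) ⊖ ∑ k (g ∘ suc) ≡ + k *ℤ c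
  tail = ∑-⊖-constant k (f ∘ suc) (g ∘ suc) (f⊖g≡c ∘ suc)

equal-∑⇒constant-⊖≡0 : ∀ k (f g : Fin (suc k) → ℕ) {c} →
  ∑ (suc k) f ≡ ∑ (suc k) g → (∀ i → f i ⊖ g i ≡ c) → c ≡ + 0
equal-∑⇒constant-⊖≡0 k f g {c} ∑f≡∑g f⊖g≡c
  with ℤ.i*j≡0⇒i≡0∨j≡0 (+ suc k) sum≡0
  where
  sum≡0 : + suc k *ℤ c ≡ + 0
  sum≡0 = begin
    + suc k *ℤ c                ≡⟨ ∑-⊖-constant (suc k) f g f⊖g≡c ⟨
    ∑ (suc k) f ⊖ ∑ (suc k) g   ≡⟨ cong (_⊖ ∑ (suc k) g) ∑f≡∑g ⟩
    ∑ (suc k) g ⊖ ∑ (suc k) g   ≡⟨ ℤ.n⊖n≡0 (∑ (suc k) g) ⟩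
    + 0                         ∎
... | inj₂ c≡0 = c≡0

[1+m]%n≡[1+m%n]%n : ∀ m n .{{_ : NonZero n}} → suc m % n ≡ suc (m % n) % n
[1+m]%n≡[1+m%n]%n m n = begin
  suc m % n                     ≡⟨ cong (λ x → suc x % n) (m≡m%n+[m/n]*n m n) ⟩
  (suc (m % n) + m / n * n) % n ≡⟨ [m+kn]%n≡m%n (suc (m % n)) (m / n) n ⟩
  suc (m % n) % n               ∎

toℕ-mod : ∀ t k .{{_ : NonZero k}} → toℕ (t mod k) ≡ t % k
toℕ-mod t k = toℕ-fromℕ< _

toℕ-[1+t]mod : ∀ t k .{{_ : NonZero k}} → toℕ (suc t mod k) ≡ suc (t % k) % k
toℕ-[1+t]mod t k = trans (toℕ-mod (suc t) k) ([1+m]%n≡[1+m%n]%n t k)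

data SucMod (k t : ℕ) : Set where
  step : toℕ (suc t mod suc k) ≡ suc (toℕ (t mod suc k)) → SucMod k t
  wrap : t mod suc k ≡ fromℕ k → suc t mod suc k ≡ zero → SucMod k t

sucMod : ∀ k t → SucMod k t
sucMod k t with m≤n⇒m<n∨m≡n (m%n<n t (suc k))
... | inj₁ 1+r<1+k = step (begin
  toℕ (suc t mod suc k)    ≡⟨ toℕ-[1+t]mod t (suc k) ⟩
  suc (t % suc k) % suc k  ≡⟨ m<n⇒m%n≡m 1+r<1+k ⟩
  suc (t % suc k)          ≡⟨ cong suc (toℕ-mod t (suc k)) ⟨
  suc (toℕ (t mod suc k))  ∎)
... | inj₂ 1+r≡1+k = wrap (toℕ-injective r≡k) (toℕ-injective (begin
  toℕ (suc t mod suc k)    ≡⟨ toℕ-[1+t]mod t (suc k) ⟩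
  suc (t % suc k) % suc k  ≡⟨ cong (_% suc k) 1+r≡1+k ⟩
  suc k % suc k            ≡⟨ n%n≡0 (suc k) ⟩
  0                        ∎))
  where
  r≡k : toℕ (t mod suc k) ≡ toℕ (fromℕ k)
  r≡k = trans (toℕ-mod t (suc k)) (trans (suc-injective 1+r≡1+k) (sym (toℕ-fromℕ k)))

mod≡zero⇒∣ : ∀ {t k} → t mod suc k ≡ zero → suc k ∣ t
mod≡zero⇒∣ {t} {k} eq = m%n≡0⇒n∣m t (suc k) (trans (sym (toℕ-mod t (suc k))) (cong toℕ eq))

%-≡⇒∣∸ : ∀ {t t'} k .{{_ : NonZero k}} → t % k ≡ t' % k → k ∣ t' ∸ t
%-≡⇒∣∸ {t} {t'} k eq = divides (t' / k ∸ t / k) (begin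
  t' ∸ t                      ≡⟨ cong₂ _∸_ (m≡m%n+[m/n]*n t' k) (m≡m%n+[m/n]*n t k) ⟩
  (t' % k + q') ∸ (t % k + q)  ≡⟨ cong (λ r → (r + q') ∸ (t % k + q)) (sym eq) ⟩
  (t % k + q') ∸ (t % k + q)   ≡⟨ [m+n]∸[m+o]≡n∸o (t % k) q' q ⟩
  q' ∸ q                       ≡⟨ *-distribʳ-∸ k (t' / k) (t / k) ⟨
  (t' / k ∸ t / k) * k         ∎)
  where
  q q' : ℕ
  q  = t / k * k
  q' = t' / k * k

∣∧<⇒≡0 : ∀ {d x} → d ∣ x → x < d → x ≡ 0
∣∧<⇒≡0 {x = zero}  _   _   = refl
∣∧<⇒≡0 {x = suc _} d∣x x<d = contradiction (∣⇒≤ d∣x) (<⇒≱ x<d)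

gcd≡1⇒*∣ : ∀ {m n k} → gcd m n ≡ 1 → m ∣ k → n ∣ k → m * n ∣ k
gcd≡1⇒*∣ {m} {n} {k} gcd≡1 m∣k n∣k = subst (_∣ k) lcm≡m*n (lcm-least m∣k n∣k)
  where
  lcm≡m*n : lcm m n ≡ m * n
  lcm≡m*n = trans (sym (*-identityˡ _)) (trans (cong (_* lcm m n) (sym gcd≡1)) (gcd*lcm m n))

∣∸∧<⇒≡ : ∀ {d s s'} → s ≤ s' → s' < d → d ∣ s' ∸ s → s ≡ s'
∣∸∧<⇒≡ {s = s} {s'} s≤s' s'<d d∣s'∸s =
  ≤-antisym s≤s' (m∸n≡0⇒m≤n (∣∧<⇒≡0 d∣s'∸s (≤-<-trans (m∸n≤m s' s) s'<d)))

%-injective : ∀ {m n t t'} .{{_ : NonZero m}} .{{_ : NonZero n}} → gcd m n ≡ 1 →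
  t < m * n → t' < m * n → t % m ≡ t' % m → t % n ≡ t' % n → t ≡ t'
%-injective {m} {n} {t} {t'} gcd≡1 t< t'< eqₘ eqₙ with ≤-total t t'
... | inj₁ t≤t' = ∣∸∧<⇒≡ t≤t' t'< (gcd≡1⇒*∣ gcd≡1 (%-≡⇒∣∸ m eqₘ) (%-≡⇒∣∸ n eqₙ))
... | inj₂ t'≤t =
  sym (∣∸∧<⇒≡ t'≤t t< (gcd≡1⇒*∣ gcd≡1 (%-≡⇒∣∸ m (sym eqₘ)) (%-≡⇒∣∸ n (sym eqₙ))))

injective⇒surjective : ∀ {k} (f : Fin k → Fin k) → Injective _≡_ _≡_ f → ∀ y → ∃ λ x → f x ≡ y
injective⇒surjective {suc k} f f-injective y with any? (λ x → f x ≟ᶠ y)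
... | yes hit  = hit
... | no  miss = contradiction (injective⇒≤ avoid-injective) (n≮n k)
  where
  y≢f : ∀ x → y ≢ f x
  y≢f x y≡fx = miss (x , sym y≡fx)
  avoid : Fin (suc k) → Fin k
  avoid x = punchOut (y≢f x)
  avoid-injective : Injective _≡_ _≡_ avoid
  avoid-injective {x} {x'} = f-injective ∘ punchOut-injective (y≢f x) (y≢f x')

crt-surjective : ∀ {m n} .{{_ : NonZero m}} .{{_ : NonZero n}} → gcd m n ≡ 1 →
  ∀ (i : Fin m) (j : Fin n) → ∃ λ t → t < m * n × t mod m ≡ i × t mod n ≡ j
crt-surjective {m} {n} gcd≡1 i j =
  let t , code[t]≡code[i,j] = injective⇒surjective code code-injective (combine i j)
      t-mod-m≡i , t-mod-n≡j = combine-injective _ _ i j code[t]≡code[i,j]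
  in toℕ t , toℕ<n t , t-mod-m≡i , t-mod-n≡j
  where
  mod-≡⇒%-≡ : ∀ {t t'} k .{{_ : NonZero k}} → t mod k ≡ t' mod k → t % k ≡ t' % k
  mod-≡⇒%-≡ {t} {t'} k eq = trans (sym (toℕ-mod t k)) (trans (cong toℕ eq) (toℕ-mod t' k))
  code : Fin (m * n) → Fin (m * n)
  code t = combine (toℕ t mod m) (toℕ t mod n)
  code-injective : Injective _≡_ _≡_ code
  code-injective {t} {t'} eq =
    let eqₘ , eqₙ = combine-injective _ _ _ _ eq
    in toℕ-injective
         (%-injective gcd≡1 (toℕ<n t) (toℕ<n t') (mod-≡⇒%-≡ m eqₘ) (mod-≡⇒%-≡ n eqₙ))

DiagonalInvariant : ∀ {m n} {X : Set} → (Fin m → Fin n → X) → Set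
DiagonalInvariant D = ∀ {i i' j j'} → toℕ i' ≡ suc (toℕ i) → toℕ j' ≡ suc (toℕ j) → D i j ≡ D i' j'

record ShiftInvariant {m n} {X : Set} (D : Fin (suc m) → Fin (suc n) → X) : Set where
  field
    diagonal : DiagonalInvariant D
    rowWrap  : ∀ {i i'} → toℕ i' ≡ suc (toℕ i) → D i (fromℕ n) ≡ D i' zero
    colWrap  : ∀ {j j'} → toℕ j' ≡ suc (toℕ j) → D (fromℕ m) j ≡ D zero j'

module _ {m n} {X : Set} {D : Fin (suc m) → Fin (suc n) → X} (invariant : ShiftInvariant D) where
  open ShiftInvariant invariant

  shift-step : ∀ t → ¬ (suc t mod suc m ≡ zero × suc t mod suc n ≡ zero) →
    D (t mod suc m) (t mod suc n) ≡ D (suc t mod suc m) (suc t mod suc n)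
  shift-step t not-corner with sucMod m t | sucMod n t
  ... | step i↑ | step j↑ = diagonal i↑ j↑
  ... | step i↑ | wrap j≡last j'≡0 =
    trans (cong (D _) j≡last) (trans (rowWrap i↑) (cong (D _) (sym j'≡0)))
  ... | wrap i≡last i'≡0 | step j↑ =
    trans (cong (λ i → D i _) i≡last) (trans (colWrap j↑) (cong (λ i → D i _) (sym i'≡0)))
  ... | wrap _ i'≡0 | wrap _ j'≡0 = contradiction (i'≡0 , j'≡0) not-corner

  along-walk : gcd (suc m) (suc n) ≡ 1 → ∀ t → t < suc m * suc n →
    D (t mod suc m) (t mod suc n) ≡ D zero zero
  along-walk gcd≡1 zero    _    = refl
  along-walk gcd≡1 (suc t) t+1< =
    trans (sym (shift-step t not-corner)) (along-walk gcd≡1 t (<⇒≤ t+1<))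
    where
    not-corner : ¬ (suc t mod suc m ≡ zero × suc t mod suc n ≡ zero)
    not-corner (i'≡0 , j'≡0) =
      1+n≢0 (∣∧<⇒≡0 (gcd≡1⇒*∣ gcd≡1 (mod≡zero⇒∣ i'≡0) (mod≡zero⇒∣ j'≡0)) t+1<)

  shiftInvariant⇒constant : gcd (suc m) (suc n) ≡ 1 → ∀ i j → D i j ≡ D zero zero
  shiftInvariant⇒constant gcd≡1 i j with crt-surjective gcd≡1 i j
  ... | t , t< , refl , refl = along-walk gcd≡1 t t<

diff : ∀ {m n} → BinMatrix m n → BinMatrix m n → Fin m → Fin n → ℤ
diff A B i j = bit (A i j) ⊖ bit (B i j)

diff≡0⇒≡ : ∀ x y → bit x ⊖ bit y ≡ + 0 → x ≡ y
diff≡0⇒≡ true  true  _ = refl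
diff≡0⇒≡ false false _ = refl
diff≡0⇒≡ true  false ()
diff≡0⇒≡ false true  ()


⇔true⇒≡ : ∀ {x y} → (x ≡ true → y ≡ true) → (y ≡ true → x ≡ true) → x ≡ y
⇔true⇒≡ {true}  x⇒y _   = sym (x⇒y refl)
⇔true⇒≡ {false} {true}  _ y⇒x = y⇒x refl
⇔true⇒≡ {false} {false} _ _   = refl

periodical⇒diagonalInvariant : ∀ {m n} {A : BinMatrix m n} →
  Periodical (+ 1) (+ 1) A → DiagonalInvariant A
periodical⇒diagonalInvariant periodical {i} {i'} {j} {j'} i↑ j↑ = ⇔true⇒≡
  (λ Aij  → proj₁ (periodical i i' j j' Aij) (forward i↑) (forward j↑))
  (λ Ai'j' → proj₂ (periodical i' i j' j Ai'j') (backward i↑) (backward j↑))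
  where
  forward : ∀ {x y} → y ≡ suc x → + y ≡ + x +ℤ + 1
  forward {x} refl = cong +_ (+-comm 1 x)
  backward : ∀ {x y} → y ≡ suc x → + x ≡ + y - + 1
  backward {x} refl = sym (trans (ℤ.[1+m]⊖[1+n]≡m⊖n x 0) (ℤ.⊖-≥ z≤n))

diff-rowWrap : ∀ {m n} {A B : BinMatrix m (suc n)} → DiagonalInvariant A → DiagonalInvariant B →
  (∀ i → rowSum A i ≡ rowSum B i) →
  ∀ {r r'} → toℕ r' ≡ suc (toℕ r) → diff A B r (fromℕ n) ≡ diff A B r' zero
diff-rowWrap {n = n} {A} {B} diagA diagB rows {r} {r'} r↑ =
  ∑-shift-⊖ n (bit ∘ A r) (bit ∘ A r') (bit ∘ B r) (bit ∘ B r')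
    (λ j → cong bit (diagA r↑ (j↑ j))) (λ j → cong bit (diagB r↑ (j↑ j))) (rows r) (rows r')
  where
  j↑ : ∀ j → toℕ (suc j) ≡ suc (toℕ (inject₁ j))
  j↑ j = cong suc (sym (toℕ-inject₁ j))

diff-shiftInvariant : ∀ {m n} {A B : BinMatrix (suc m) (suc n)} →
  DiagonalInvariant A → DiagonalInvariant B →
  (∀ i → rowSum A i ≡ rowSum B i) → (∀ j → colSum A j ≡ colSum B j) → ShiftInvariant (diff A B)
diff-shiftInvariant diagA diagB rows cols = record
  { diagonal = λ i↑ j↑ → cong₂ _⊖_ (cong bit (diagA i↑ j↑)) (cong bit (diagB i↑ j↑))
  ; rowWrap  = diff-rowWrap diagA diagB rows
  ; colWrap  = diff-rowWrap (λ j↑ i↑ → diagA i↑ j↑) (λ j↑ i↑ → diagB i↑ j↑) cols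
  }

mainTheorem1 : (m n : ℕ) → m ≥ 1 → n ≥ 1 → gcd n m ≡ 1 →
    (R : Fin m → ℕ) (C : Fin n → ℕ) (A B : BinMatrix m n) →
    Periodical (+ 1) (+ 1) A → (∀ i → rowSum A i ≡ R i) → (∀ j → colSum A j ≡ C j) →
    Periodical (+ 1) (+ 1) B → (∀ i → rowSum B i ≡ R i) → (∀ j → colSum B j ≡ C j) →
    ∀ i j → A i j ≡ B i j
mainTheorem1 (suc m) (suc n) _ _ gcd≡1 R C A B perA rowA colA perB rowB colB i j =
  diff≡0⇒≡ (A i j) (B i j) (trans (constant i j) constant≡0)
  where
  rows : ∀ i → rowSum A i ≡ rowSum B i
  rows i = trans (rowA i) (sym (rowB i))
  cols : ∀ j → colSum A j ≡ colSum B j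
  cols j = trans (colA j) (sym (colB j))
  constant : ∀ i j → diff A B i j ≡ diff A B zero zero
  constant = shiftInvariant⇒constant
    (diff-shiftInvariant (periodical⇒diagonalInvariant perA) (periodical⇒diagonalInvariant perB)
      rows cols)
    (trans (gcd-comm (suc m) (suc n)) gcd≡1)
  constant≡0 : diff A B zero zero ≡ + 0
  constant≡0 = equal-∑⇒constant-⊖≡0 n (bit ∘ A zero) (bit ∘ B zero) (rows zero) (constant zero)
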